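{- Let $n \ge 7$ and $k = \lfloor n/5 \rfloor$. Then $$F(P_n \Box P_n) \ge \begin{cases} n^2 - 4k, & \text{if } n \equiv 0, 1 \text{ or } 4 \pmod 5,\\ n^2 - n + k + 1, & \text{if } n \equiv 2 \text{ or } 3 \pmod 5.\end{cases}$$
   Context: For a graph $G$ and vertex $v$, $N[v]$ denotes the closed neighborhood of $v$. A set $S\subseteq V(G)$ is a 2-packing if $|N[x]\cap S|\le 1$ for all $x\in V(G)$. The efficient domination number is $F(G)=\max\{\sum_{v\in S}(1+\deg v) : S \text{ a 2-packing of } G\}$. $P_n\Box P_n$ is the Cartesian product of two paths on $n$ vertices (the $n\times n$ grid graph). -}

module Defs where

open import Data.Nat using (ℕ; zero; suc; _+_; _*_; _≤_)
open import Data.Nat.Properties using (_≟_)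
open import Data.Nat.ListAction using (sum)
open import Data.Fin using (Fin; toℕ; _≟_)
open import Data.Bool using (Bool; true; false; _∨_; _∧_; T)
open import Data.List using (List; map; filter; length; allFin; cartesianProduct)
open import Data.List.Relation.Unary.Unique.Propositional using (Unique)
open import Data.Product using (_×_; _,_; Σ)
open import Relation.Nullary.Decidable using (⌊_⌋; T?)
open import Relation.Binary.PropositionalEquality using (_≡_)

pathAdj : {n : ℕ} → Fin n → Fin n → Bool
pathAdj a b = ⌊ suc (toℕ a) Data.Nat.Properties.≟ toℕ b ⌋ ∨ ⌊ suc (toℕ b) Data.Nat.Properties.≟ toℕ a ⌋

GridV : ℕ → Set
GridV n = Fin n × Fin n

gridAdj : {n : ℕ} → GridV n → GridV n → Bool
gridAdj (i , j) (i' , j') =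
  (⌊ i Data.Fin.≟ i' ⌋ ∧ pathAdj j j') ∨ (⌊ j Data.Fin.≟ j' ⌋ ∧ pathAdj i i')

gridVertices : (n : ℕ) → List (GridV n)
gridVertices n = cartesianProduct (allFin n) (allFin n)

_≟V_ : {n : ℕ} → (u v : GridV n) → Bool
(i , j) ≟V (i' , j') = ⌊ i Data.Fin.≟ i' ⌋ ∧ ⌊ j Data.Fin.≟ j' ⌋

gridDeg : {n : ℕ} → GridV n → ℕ
gridDeg {n} v = length (filter (λ u → T? (gridAdj v u)) (gridVertices n))

inClosedNbhd : {n : ℕ} → GridV n → GridV n → Bool
inClosedNbhd x u = (u ≟V x) ∨ gridAdj x u

closedNbhdCount : {n : ℕ} → GridV n → List (GridV n) → ℕ
closedNbhdCount x S = length (filter (λ u → T? (inClosedNbhd x u)) S)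

Is2Packing : {n : ℕ} → List (GridV n) → Set
Is2Packing {n} S = Unique S × (∀ (x : GridV n) → closedNbhdCount x S ≤ 1)

weight : {n : ℕ} → List (GridV n) → ℕ
weight S = sum (map (λ v → suc (gridDeg v)) S)

-- F(P_n □ P_n) ≥ m.  F is the maximum of `weight` over the finite nonempty
-- family of 2-packings, so F ≥ m iff some 2-packing has weight ≥ m.
F-grid≥ : ℕ → ℕ → Set
F-grid≥ n m = Σ (List (GridV n)) λ S → Is2Packing S × (m ≤ weight S)

-- The points (a , b) with a + 2b + c ≡ 0 (mod 5) form a perfect code of the infinite grid:
-- the five points of a closed neighbourhood take pairwise different values of a + 2b mod 5,
-- so every point is dominated by exactly one codeword, its neighbour in a direction fixed by
-- its residue. Inside the n × n grid the code is still a 2-packing, and by double counting its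
-- weight Σ_{u ∈ S} (1 + deg u) is at least n² minus the number of vertices whose dominating
-- codeword falls outside the grid. Such a vertex lies on one side of the grid and has the
-- residue belonging to that side, so each side contributes one vertex per five, about n/5;
-- the shift c is chosen according to n mod 5 to keep the remaining boundary terms small.

module Submission where

open import Defs
open import Data.Bool using (Bool; true; false; _∨_; _∧_; T)
open import Data.Bool.Properties using (T-∨; T-∧; ∨-comm)
open import Data.Empty using (⊥-elim)
open import Data.Fin using (Fin; toℕ; fromℕ<; inject₁) renaming (zero to fzero; suc to fsuc; _≟_ to _≟ᶠ_)
open import Data.Fin.Properties using (toℕ-injective; toℕ-fromℕ<; toℕ-inject₁; toℕ<n)
open import Data.List using (List; []; _∷_; _++_; map; filter; length; allFin; tabulate; cartesianProduct)
open import Data.List.Properties using (map-++; map-∘; map-tabulate; filter-none)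
open import Data.List.Membership.Propositional using (_∈_)
open import Data.List.Membership.Propositional.Properties using (∈-allFin; ∈-cartesianProduct⁺; ∈-filter⁺; ∈-filter⁻)
import Data.List.Relation.Unary.All as All
open import Data.List.Relation.Unary.Any using (here; there)
open import Data.List.Relation.Unary.Unique.Propositional using (Unique; []; _∷_)
import Data.List.Relation.Unary.Unique.Propositional.Properties as Unique
open import Data.Nat using (ℕ; zero; suc; _+_; _*_; _∸_; _≤_; _<_; _/_; _%_; _≡ᵇ_; z≤n; s≤s; NonZero)
open import Data.Nat.DivMod using (%-distribˡ-+; [m+kn]%n≡m%n; m≡m%n+[m/n]*n; m%n<n)
open import Data.Nat.ListAction using (sum)
open import Data.Nat.ListAction.Properties using (sum-++)
open import Data.Nat.Properties
open import Algebra.Properties.CommutativeSemigroup +-commutativeSemigroup using (interchange)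
open import Data.Nat.Tactic.RingSolver using (solve-∀)
open import Data.Product using (_×_; _,_; proj₂; ∃-syntax; Σ-syntax)
open import Data.Product.Properties using (,-injective)
open import Data.Sum using (_⊎_; inj₁; inj₂)
import Data.Sum as Sum
open import Data.Unit using (tt)
open import Function using (_∘_)
open import Function.Bundles using (_⇔_; mk⇔; module Equivalence)
open import Relation.Binary.PropositionalEquality
open import Relation.Nullary using (¬_; Dec; yes; no)
open import Relation.Nullary.Decidable using (T?; ⌊_⌋; toWitness; fromWitness)
open import Relation.Unary using (Pred; Decidable)

open Equivalence using (to; from)

𝟙 : Bool → ℕ
𝟙 true = 1
𝟙 false = 0

T⇒1≤𝟙 : ∀ {b} → T b → 1 ≤ 𝟙 b
T⇒1≤𝟙 {true} _ = s≤s z≤n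

𝟙-∨ : ∀ a b → 𝟙 (a ∨ b) ≤ 𝟙 a + 𝟙 b
𝟙-∨ true _ = s≤s z≤n
𝟙-∨ false _ = ≤-refl

module _ {a} {A : Set a} where

  ∑∈ : List A → (A → ℕ) → ℕ
  ∑∈ xs f = sum (map f xs)

  syntax ∑∈ xs (λ x → e) = ∑[ x ∈ xs ] e

  ∑-cong : ∀ {f g : A → ℕ} xs → (∀ x → f x ≡ g x) → ∑∈ xs f ≡ ∑∈ xs g
  ∑-cong [] _ = refl
  ∑-cong (x ∷ xs) f≡g = cong₂ _+_ (f≡g x) (∑-cong xs f≡g)

  ∑-mono-≤ : ∀ {f g : A → ℕ} xs → (∀ x → f x ≤ g x) → ∑∈ xs f ≤ ∑∈ xs g
  ∑-mono-≤ [] _ = z≤n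
  ∑-mono-≤ (x ∷ xs) f≤g = +-mono-≤ (f≤g x) (∑-mono-≤ xs f≤g)

  ∑-zero : ∀ xs → ∑[ x ∈ xs ] 0 ≡ 0
  ∑-zero [] = refl
  ∑-zero (_ ∷ xs) = ∑-zero xs

  ∑-distrib-+ : ∀ (f g : A → ℕ) xs → ∑[ x ∈ xs ] (f x + g x) ≡ ∑∈ xs f + ∑∈ xs g
  ∑-distrib-+ f g [] = refl
  ∑-distrib-+ f g (x ∷ xs) = begin
    f x + g x + ∑[ y ∈ xs ] (f y + g y)  ≡⟨ cong (f x + g x +_) (∑-distrib-+ f g xs) ⟩
    f x + g x + (∑∈ xs f + ∑∈ xs g)      ≡⟨ interchange (f x) (g x) (∑∈ xs f) (∑∈ xs g) ⟩
    f x + ∑∈ xs f + (g x + ∑∈ xs g)      ∎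
    where open ≡-Reasoning

  ∑-++ : ∀ (f : A → ℕ) xs ys → ∑∈ (xs ++ ys) f ≡ ∑∈ xs f + ∑∈ ys f
  ∑-++ f xs ys = trans (cong sum (map-++ f xs ys)) (sum-++ (map f xs) (map f ys))

  length-filter≡∑𝟙 : ∀ (p : A → Bool) xs → length (filter (T? ∘ p) xs) ≡ ∑[ x ∈ xs ] 𝟙 (p x)
  length-filter≡∑𝟙 p [] = refl
  length-filter≡∑𝟙 p (x ∷ xs) with p x
  ... | true = cong suc (length-filter≡∑𝟙 p xs)
  ... | false = length-filter≡∑𝟙 p xs

  1≤length : ∀ {x : A} {xs} → x ∈ xs → 1 ≤ length xs
  1≤length (here _) = s≤s z≤n
  1≤length (there _) = s≤s z≤n

  length-filter≤1 : ∀ {p} {P : Pred A p} (P? : Decidable P) {xs} → Unique xs →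
                    (∀ {x y} → x ∈ xs → y ∈ xs → P x → P y → x ≡ y) → length (filter P? xs) ≤ 1
  length-filter≤1 P? [] _ = z≤n
  length-filter≤1 {P = P} P? {x ∷ xs} (x∉xs ∷ uniq) P-unique with P? x
  ... | yes Px = s≤s (≤-reflexive (cong length (filter-none P? (All.tabulate ¬P))))
    where ¬P : ∀ {y} → y ∈ xs → ¬ P y
          ¬P y∈xs Py = All.lookup x∉xs y∈xs (P-unique (here refl) (there y∈xs) Px Py)
  ... | no _ = length-filter≤1 P? uniq (λ x∈ y∈ → P-unique (there x∈) (there y∈))

∑-map : ∀ {a b} {A : Set a} {B : Set b} (f : B → ℕ) (g : A → B) xs → ∑∈ (map g xs) f ≡ ∑[ x ∈ xs ] f (g x)
∑-map f g xs = cong sum (sym (map-∘ xs))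

module _ {a b} {A : Set a} {B : Set b} where

  ∑-comm : ∀ (h : A → B → ℕ) xs ys → ∑[ x ∈ xs ] ∑[ y ∈ ys ] h x y ≡ ∑[ y ∈ ys ] ∑[ x ∈ xs ] h x y
  ∑-comm h [] ys = sym (∑-zero ys)
  ∑-comm h (x ∷ xs) ys = begin
    ∑∈ ys (h x) + ∑[ x ∈ xs ] ∑[ y ∈ ys ] h x y  ≡⟨ cong (∑∈ ys (h x) +_) (∑-comm h xs ys) ⟩
    ∑∈ ys (h x) + ∑[ y ∈ ys ] ∑[ x ∈ xs ] h x y  ≡⟨ ∑-distrib-+ (h x) (λ y → ∑[ x ∈ xs ] h x y) ys ⟨
    ∑[ y ∈ ys ] (h x y + ∑[ x ∈ xs ] h x y)      ∎
    where open ≡-Reasoning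

  ∑-cartesianProduct : ∀ (f : A × B → ℕ) xs ys →
                       ∑∈ (cartesianProduct xs ys) f ≡ ∑[ x ∈ xs ] ∑[ y ∈ ys ] f (x , y)
  ∑-cartesianProduct f [] ys = refl
  ∑-cartesianProduct f (x ∷ xs) ys = begin
    ∑∈ (map (x ,_) ys ++ cartesianProduct xs ys) f           ≡⟨ ∑-++ f (map (x ,_) ys) (cartesianProduct xs ys) ⟩
    ∑∈ (map (x ,_) ys) f + ∑∈ (cartesianProduct xs ys) f    ≡⟨ cong₂ _+_ (∑-map f (x ,_) ys) (∑-cartesianProduct f xs ys) ⟩
    ∑[ y ∈ ys ] f (x , y) + ∑[ x ∈ xs ] ∑[ y ∈ ys ] f (x , y) ∎
    where open ≡-Reasoning

∑< : ℕ → (ℕ → ℕ) → ℕ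
∑< zero f = 0
∑< (suc n) f = f 0 + ∑< n (f ∘ suc)

syntax ∑< n (λ a → e) = ∑[ a < n ] e

∑<-cong : ∀ n {f g : ℕ → ℕ} → (∀ a → f a ≡ g a) → ∑< n f ≡ ∑< n g
∑<-cong zero _ = refl
∑<-cong (suc n) f≡g = cong₂ _+_ (f≡g 0) (∑<-cong n (f≡g ∘ suc))

∑<-zero : ∀ n → ∑[ a < n ] 0 ≡ 0
∑<-zero zero = refl
∑<-zero (suc n) = ∑<-zero n

∑<-const : ∀ n k → ∑[ a < n ] k ≡ n * k
∑<-const zero k = refl
∑<-const (suc n) k = cong (k +_) (∑<-const n k)

∑<-distrib-+ : ∀ n (f g : ℕ → ℕ) → ∑[ a < n ] (f a + g a) ≡ ∑< n f + ∑< n g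
∑<-distrib-+ zero f g = refl
∑<-distrib-+ (suc n) f g = begin
  f 0 + g 0 + ∑[ a < n ] (f (suc a) + g (suc a))  ≡⟨ cong (f 0 + g 0 +_) (∑<-distrib-+ n (f ∘ suc) (g ∘ suc)) ⟩
  f 0 + g 0 + (∑< n (f ∘ suc) + ∑< n (g ∘ suc))   ≡⟨ interchange (f 0) (g 0) _ _ ⟩
  f 0 + ∑< n (f ∘ suc) + (g 0 + ∑< n (g ∘ suc))   ∎
  where open ≡-Reasoning

∑<-distrib-+₄ : ∀ n (f g h k : ℕ → ℕ) →
                ∑[ a < n ] (f a + (g a + (h a + k a))) ≡ ∑< n f + (∑< n g + (∑< n h + ∑< n k))
∑<-distrib-+₄ n f g h k = begin
  ∑[ a < n ] (f a + (g a + (h a + k a)))           ≡⟨ ∑<-distrib-+ n f _ ⟩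
  ∑< n f + ∑[ a < n ] (g a + (h a + k a))          ≡⟨ cong (∑< n f +_) (∑<-distrib-+ n g _) ⟩
  ∑< n f + (∑< n g + ∑[ a < n ] (h a + k a))       ≡⟨ cong (λ r → ∑< n f + (∑< n g + r)) (∑<-distrib-+ n h k) ⟩
  ∑< n f + (∑< n g + (∑< n h + ∑< n k))            ∎
  where open ≡-Reasoning

∑<-mono-≤ : ∀ n {f g : ℕ → ℕ} → (∀ a → f a ≤ g a) → ∑< n f ≤ ∑< n g
∑<-mono-≤ zero _ = z≤n
∑<-mono-≤ (suc n) f≤g = +-mono-≤ (f≤g 0) (∑<-mono-≤ n (f≤g ∘ suc))

∑<-*ʳ : ∀ n k (f : ℕ → ℕ) → ∑[ a < n ] (f a * k) ≡ ∑< n f * k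
∑<-*ʳ zero k f = refl
∑<-*ʳ (suc n) k f = trans (cong (f 0 * k +_) (∑<-*ʳ n k (f ∘ suc))) (sym (*-distribʳ-+ k (f 0) _))

∑<-+ : ∀ m n (f : ℕ → ℕ) → ∑< (m + n) f ≡ ∑< m f + ∑[ b < n ] f (m + b)
∑<-+ zero n f = refl
∑<-+ (suc m) n f = trans (cong (f 0 +_) (∑<-+ m n (f ∘ suc))) (sym (+-assoc (f 0) _ _))

∑<-periodic : ∀ k p (f : ℕ → ℕ) → (∀ b → f (p + b) ≡ f b) → ∑< (k * p) f ≡ k * ∑< p f
∑<-periodic zero p f _ = refl
∑<-periodic (suc k) p f periodic = begin
  ∑< (p + k * p) f                  ≡⟨ ∑<-+ p (k * p) f ⟩
  ∑< p f + ∑[ b < k * p ] f (p + b)  ≡⟨ cong (∑< p f +_) (∑<-cong (k * p) periodic) ⟩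
  ∑< p f + ∑< (k * p) f             ≡⟨ cong (∑< p f +_) (∑<-periodic k p f periodic) ⟩
  ∑< p f + k * ∑< p f               ∎
  where open ≡-Reasoning

∑<-select : ∀ {n k} (g : ℕ → ℕ) → k < n → ∑[ a < n ] (g a * 𝟙 (a ≡ᵇ k)) ≡ g k
∑<-select {suc n} {zero} g _ = begin
  g 0 * 1 + ∑[ a < n ] (g (suc a) * 0)  ≡⟨ cong₂ _+_ (*-identityʳ (g 0)) (∑<-cong n (*-zeroʳ ∘ g ∘ suc)) ⟩
  g 0 + ∑[ a < n ] 0                    ≡⟨ cong (g 0 +_) (∑<-zero n) ⟩
  g 0 + 0                               ≡⟨ +-identityʳ (g 0) ⟩
  g 0                                   ∎
  where open ≡-Reasoning
∑<-select {suc n} {suc k} g (s≤s k<n) = begin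
  g 0 * 0 + ∑[ a < n ] (g (suc a) * 𝟙 (a ≡ᵇ k))  ≡⟨ cong (_+ ∑[ a < n ] (g (suc a) * 𝟙 (a ≡ᵇ k))) (*-zeroʳ (g 0)) ⟩
  ∑[ a < n ] (g (suc a) * 𝟙 (a ≡ᵇ k))            ≡⟨ ∑<-select (g ∘ suc) k<n ⟩
  g (suc k)                                      ∎
  where open ≡-Reasoning

sum-tabulate : ∀ n (g : ℕ → ℕ) → sum (tabulate {n = n} (g ∘ toℕ)) ≡ ∑< n g
sum-tabulate zero g = refl
sum-tabulate (suc n) g = cong (g 0 +_) (sum-tabulate n (g ∘ suc))

∑-allFin : ∀ n (g : ℕ → ℕ) → ∑[ i ∈ allFin n ] g (toℕ i) ≡ ∑< n g
∑-allFin n g = trans (cong sum (map-tabulate {n = n} (λ i → i) (g ∘ toℕ))) (sum-tabulate n g)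

-- Adding m * (n - 1) to both sides turns m into the multiple m * n.
%-cancelˡ-+ : ∀ m {d e n} .{{_ : NonZero n}} → (m + d) % n ≡ (m + e) % n → d % n ≡ e % n
%-cancelˡ-+ m {d} {e} {n@(suc k)} eq = begin
  d % n                          ≡⟨ absorb d ⟨
  (m + d + m * k) % n            ≡⟨ %-distribˡ-+ (m + d) (m * k) n ⟩
  ((m + d) % n + m * k % n) % n  ≡⟨ cong (λ r → (r + m * k % n) % n) eq ⟩
  ((m + e) % n + m * k % n) % n  ≡⟨ %-distribˡ-+ (m + e) (m * k) n ⟨
  (m + e + m * k) % n            ≡⟨ absorb e ⟩
  e % n                          ∎
  where
  open ≡-Reasoning
  absorb : ∀ x → (m + x + m * k) % n ≡ x % n
  absorb x = trans (cong (_% n) (rearrange m x k)) ([m+kn]%n≡m%n x m n)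
    where rearrange : ∀ m x k → m + x + m * k ≡ x + m * suc k
          rearrange = solve-∀

[m+k]%n≡[m%n+k]%n : ∀ m k n .{{_ : NonZero n}} → (m + k) % n ≡ (m % n + k) % n
[m+k]%n≡[m%n+k]%n m k n = begin
  (m + k) % n                    ≡⟨ cong (λ r → (r + k) % n) (m≡m%n+[m/n]*n m n) ⟩
  (m % n + m / n * n + k) % n    ≡⟨ cong (_% n) (+-+-swap (m % n) (m / n * n) k) ⟩
  (m % n + k + (m / n) * n) % n  ≡⟨ [m+kn]%n≡m%n (m % n + k) (m / n) n ⟩
  (m % n + k) % n                ∎
  where
  open ≡-Reasoning
  +-+-swap : ∀ r q k → r + q + k ≡ r + k + q
  +-+-swap = solve-∀

coords : ∀ {n} → GridV n → ℕ × ℕ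
coords (i , j) = toℕ i , toℕ j

coords-injective : ∀ {n} {u v : GridV n} → coords u ≡ coords v → u ≡ v
coords-injective {u = _ , _} {_ , _} eq with ,-injective eq
... | p , q = cong₂ _,_ (toℕ-injective p) (toℕ-injective q)

∈-gridVertices : ∀ {n} (u : GridV n) → u ∈ gridVertices n
∈-gridVertices (i , j) = ∈-cartesianProduct⁺ (∈-allFin i) (∈-allFin j)

gridVertices-unique : ∀ n → Unique (gridVertices n)
gridVertices-unique n = Unique.cartesianProduct⁺ (Unique.allFin⁺ n) (Unique.allFin⁺ n)

∑-gridVertices : ∀ n (g : ℕ × ℕ → ℕ) → ∑[ x ∈ gridVertices n ] g (coords x) ≡ ∑[ a < n ] ∑[ b < n ] g (a , b)
∑-gridVertices n g = begin
  ∑[ x ∈ gridVertices n ] g (coords x)                    ≡⟨ ∑-cartesianProduct (g ∘ coords) (allFin n) (allFin n) ⟩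
  ∑[ i ∈ allFin n ] ∑[ j ∈ allFin n ] g (toℕ i , toℕ j)   ≡⟨ ∑-cong (allFin n) (λ i → ∑-allFin n (λ b → g (toℕ i , b))) ⟩
  ∑[ i ∈ allFin n ] ∑[ b < n ] g (toℕ i , b)              ≡⟨ ∑-allFin n (λ a → ∑[ b < n ] g (a , b)) ⟩
  ∑[ a < n ] ∑[ b < n ] g (a , b)                          ∎
  where open ≡-Reasoning

∑-gridVertices-1 : ∀ n → ∑[ x ∈ gridVertices n ] 1 ≡ n * n
∑-gridVertices-1 n = begin
  ∑[ x ∈ gridVertices n ] 1  ≡⟨ ∑-gridVertices n (λ _ → 1) ⟩
  ∑[ a < n ] ∑[ b < n ] 1    ≡⟨ ∑<-cong n (λ _ → ∑<-const n 1) ⟩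
  ∑[ a < n ] (n * 1)         ≡⟨ ∑<-const n (n * 1) ⟩
  n * (n * 1)                ≡⟨ cong (n *_) (*-identityʳ n) ⟩
  n * n                      ∎
  where open ≡-Reasoning

⌊≟⌋-sym : ∀ {n} (i i' : Fin n) → ⌊ i ≟ᶠ i' ⌋ ≡ ⌊ i' ≟ᶠ i ⌋
⌊≟⌋-sym i i' with i ≟ᶠ i' | i' ≟ᶠ i
... | yes _  | yes _  = refl
... | no _   | no _   = refl
... | yes p  | no ¬q  = ⊥-elim (¬q (sym p))
... | no ¬p  | yes q  = ⊥-elim (¬p (sym q))

pathAdj-sym : ∀ {n} (a b : Fin n) → pathAdj a b ≡ pathAdj b a
pathAdj-sym a b = ∨-comm ⌊ suc (toℕ a) ≟ toℕ b ⌋ _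

gridAdj-sym : ∀ {n} (u v : GridV n) → gridAdj u v ≡ gridAdj v u
gridAdj-sym (i , j) (i' , j') rewrite ⌊≟⌋-sym i i' | ⌊≟⌋-sym j j' | pathAdj-sym i i' | pathAdj-sym j j' = refl

≟V⇒≡ : ∀ {n} (u v : GridV n) → T (u ≟V v) → u ≡ v
≟V⇒≡ (i , j) (i' , j') t with to (T-∧ {⌊ i ≟ᶠ i' ⌋}) t
... | p , q = cong₂ _,_ (toWitness p) (toWitness q)

data Dir : Set where
  centre east west north south : Dir

Step : Dir → ℕ × ℕ → ℕ × ℕ → Set
Step centre (a , b) (a' , b') = a ≡ a' × b ≡ b'
Step east   (a , b) (a' , b') = suc a ≡ a' × b ≡ b'
Step west   (a , b) (a' , b') = suc a' ≡ a × b ≡ b'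
Step north  (a , b) (a' , b') = a ≡ a' × suc b ≡ b'
Step south  (a , b) (a' , b') = a ≡ a' × suc b' ≡ b

step-functional : ∀ d {p q q'} → Step d p q → Step d p q' → q ≡ q'
step-functional centre {_ , _} {_ , _} {_ , _} (refl , refl) (refl , refl) = refl
step-functional east   {_ , _} {_ , _} {_ , _} (refl , refl) (refl , refl) = refl
step-functional west   {_ , _} {_ , _} {_ , _} (refl , refl) (refl , refl) = refl
step-functional north  {_ , _} {_ , _} {_ , _} (refl , refl) (refl , refl) = refl
step-functional south  {_ , _} {_ , _} {_ , _} (refl , refl) (refl , refl) = refl

T-pathAdj : ∀ {n} (a b : Fin n) → T (pathAdj a b) ⇔ (suc (toℕ a) ≡ toℕ b ⊎ suc (toℕ b) ≡ toℕ a)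
T-pathAdj a b = mk⇔ (Sum.map toWitness toWitness ∘ to (T-∨ {⌊ suc (toℕ a) ≟ toℕ b ⌋}))
                    (from (T-∨ {⌊ suc (toℕ a) ≟ toℕ b ⌋}) ∘ Sum.map fromWitness fromWitness)

module _ {n} (i j i' j' : Fin n) where
  private
    same vertical horizontal : Bool
    same = ⌊ i' ≟ᶠ i ⌋ ∧ ⌊ j' ≟ᶠ j ⌋
    vertical = ⌊ i ≟ᶠ i' ⌋ ∧ pathAdj j j'
    horizontal = ⌊ j ≟ᶠ j' ⌋ ∧ pathAdj i i'

    T-inClosedNbhd : T (inClosedNbhd (i , j) (i' , j')) ⇔ (T same ⊎ T vertical ⊎ T horizontal)
    T-inClosedNbhd = mk⇔ (Sum.map₂ (to (T-∨ {vertical})) ∘ to (T-∨ {same}))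
                         (from (T-∨ {same}) ∘ Sum.map₂ (from (T-∨ {vertical})))

  inClosedNbhd⇒Step : T (inClosedNbhd (i , j) (i' , j')) → ∃[ d ] Step d (toℕ i , toℕ j) (toℕ i' , toℕ j')
  inClosedNbhd⇒Step t with to T-inClosedNbhd t
  ... | inj₁ s with to (T-∧ {⌊ i' ≟ᶠ i ⌋}) s
  ...   | p , q = centre , cong toℕ (sym (toWitness p)) , cong toℕ (sym (toWitness q))
  inClosedNbhd⇒Step t | inj₂ (inj₁ v) with to (T-∧ {⌊ i ≟ᶠ i' ⌋}) v
  ...   | p , q = Sum.[ (λ r → north , cong toℕ (toWitness p) , r) , (λ r → south , cong toℕ (toWitness p) , r) ]′
                    (to (T-pathAdj j j') q)
  inClosedNbhd⇒Step t | inj₂ (inj₂ h) with to (T-∧ {⌊ j ≟ᶠ j' ⌋}) h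
  ...   | p , q = Sum.[ (λ r → east , r , cong toℕ (toWitness p)) , (λ r → west , r , cong toℕ (toWitness p)) ]′
                    (to (T-pathAdj i i') q)

  Step⇒inClosedNbhd : ∀ d → Step d (toℕ i , toℕ j) (toℕ i' , toℕ j') → T (inClosedNbhd (i , j) (i' , j'))
  Step⇒inClosedNbhd d st = from T-inClosedNbhd (by-direction d st)
    where
    along : ∀ {a a' : Fin n} b b' → a ≡ a' → T (pathAdj b b') → T (⌊ a ≟ᶠ a' ⌋ ∧ pathAdj b b')
    along _ _ p q = from (T-∧ {⌊ _ ≟ᶠ _ ⌋}) (fromWitness p , q)
    by-direction : ∀ d → Step d (toℕ i , toℕ j) (toℕ i' , toℕ j') → T same ⊎ T vertical ⊎ T horizontal
    by-direction centre (p , q) = inj₁ (from (T-∧ {⌊ i' ≟ᶠ i ⌋}) (fromWitness (toℕ-injective (sym p)) , fromWitness (toℕ-injective (sym q))))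
    by-direction east (p , q) = inj₂ (inj₂ (along i i' (toℕ-injective q) (from (T-pathAdj i i') (inj₁ p))))
    by-direction west (p , q) = inj₂ (inj₂ (along i i' (toℕ-injective q) (from (T-pathAdj i i') (inj₂ p))))
    by-direction north (p , q) = inj₂ (inj₁ (along j j' (toℕ-injective p) (from (T-pathAdj j j') (inj₁ q))))
    by-direction south (p , q) = inj₂ (inj₁ (along j j' (toℕ-injective p) (from (T-pathAdj j j') (inj₂ q))))

exits : ℕ → Dir → ℕ × ℕ → Bool
exits n centre _       = false
exits n east   (a , _) = suc a ≡ᵇ n
exits n west   (a , _) = a ≡ᵇ 0
exits n north  (_ , b) = suc b ≡ᵇ n
exits n south  (_ , b) = b ≡ᵇ 0

step-or-exits : ∀ {n} d (x : GridV n) → T (exits n d (coords x)) ⊎ Σ[ u ∈ GridV n ] Step d (coords x) (coords u)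
step-or-exits centre (i , j) = inj₂ ((i , j) , refl , refl)
step-or-exits {n} east (i , j) with suc (toℕ i) ≟ n
... | yes last = inj₁ (≡⇒≡ᵇ _ _ last)
... | no ¬last = inj₂ ((fromℕ< i+1<n , j) , sym (toℕ-fromℕ< i+1<n) , refl)
  where
  i+1<n : suc (toℕ i) < n
  i+1<n = ≤∧≢⇒< (toℕ<n i) ¬last
step-or-exits west (fzero , j) = inj₁ tt
step-or-exits west (fsuc i , j) = inj₂ ((inject₁ i , j) , cong suc (toℕ-inject₁ i) , refl)
step-or-exits {n} north (i , j) with suc (toℕ j) ≟ n
... | yes last = inj₁ (≡⇒≡ᵇ _ _ last)
... | no ¬last = inj₂ ((i , fromℕ< j+1<n) , refl , sym (toℕ-fromℕ< j+1<n))
  where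
  j+1<n : suc (toℕ j) < n
  j+1<n = ≤∧≢⇒< (toℕ<n j) ¬last
step-or-exits south (i , fzero) = inj₁ tt
step-or-exits south (i , fsuc j) = inj₂ ((i , inject₁ j) , refl , cong suc (toℕ-inject₁ j))

value : ℕ → ℕ × ℕ → ℕ
value c (a , b) = a + 2 * b + c

IsCodeword : ℕ → ℕ × ℕ → Set
IsCodeword c p = value c p % 5 ≡ 0

isCodeword? : ∀ {n} c (x : GridV n) → Dec (IsCodeword c (coords x))
isCodeword? c x = value c (coords x) % 5 ≟ 0

codeSet : ∀ n → ℕ → List (GridV n)
codeSet n c = filter (isCodeword? c) (gridVertices n)

-- Shifted by 2 so that step-value needs no truncated subtraction.
offset : Dir → ℕ
offset centre = 2
offset east   = 3
offset west   = 1
offset north  = 4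
offset south  = 0

step-value : ∀ c d {p q} → Step d p q → value c q + 2 ≡ value c p + offset d
step-value c centre {_ , _} {_ , _} (refl , refl) = refl
step-value c east   {a , b} {_ , _} (refl , refl) = shift a b c
  where shift : ∀ a b c → suc a + 2 * b + c + 2 ≡ a + 2 * b + c + 3
        shift = solve-∀
step-value c west   {_ , b} {a , _} (refl , refl) = shift a b c
  where shift : ∀ a b c → a + 2 * b + c + 2 ≡ suc a + 2 * b + c + 1
        shift = solve-∀
step-value c north  {a , b} {_ , _} (refl , refl) = shift a b c
  where shift : ∀ a b c → a + 2 * suc b + c + 2 ≡ a + 2 * b + c + 4
        shift = solve-∀
step-value c south  {a , _} {_ , b} (refl , refl) = shift a b c
  where shift : ∀ a b c → a + 2 * b + c + 2 ≡ a + 2 * suc b + c + 0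
        shift = solve-∀

offset-injective : ∀ d e → offset d % 5 ≡ offset e % 5 → d ≡ e
offset-injective d e eq = trans (sym (inverse d)) (trans (cong direction eq) (inverse e))
  where
  direction : ℕ → Dir
  direction 0 = south
  direction 1 = west
  direction 2 = centre
  direction 3 = east
  direction _ = north
  inverse : ∀ d → direction (offset d % 5) ≡ d
  inverse centre = refl
  inverse east   = refl
  inverse west   = refl
  inverse north  = refl
  inverse south  = refl

codeword⇔ : ∀ c d {p q} → Step d p q → IsCodeword c q ⇔ ((value c p + offset d) % 5 ≡ 2)
codeword⇔ c d {p} {q} st = mk⇔ codeword⇒ codeword⇐
  where
  open ≡-Reasoning
  shift : (value c q + 2) % 5 ≡ (value c p + offset d) % 5
  shift = cong (_% 5) (step-value c d st)
  codeword⇒ : IsCodeword c q → (value c p + offset d) % 5 ≡ 2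
  codeword⇒ q≡0 = begin
    (value c p + offset d) % 5  ≡⟨ shift ⟨
    (value c q + 2) % 5         ≡⟨ [m+k]%n≡[m%n+k]%n (value c q) 2 5 ⟩
    (value c q % 5 + 2) % 5     ≡⟨ cong (λ r → (r + 2) % 5) q≡0 ⟩
    2                           ∎
  codeword⇐ : (value c p + offset d) % 5 ≡ 2 → IsCodeword c q
  codeword⇐ p+d≡2 = %-cancelˡ-+ 2 {value c q} {0} (begin
    (2 + value c q) % 5         ≡⟨ cong (_% 5) (+-comm 2 (value c q)) ⟩
    (value c q + 2) % 5         ≡⟨ shift ⟩
    (value c p + offset d) % 5  ≡⟨ p+d≡2 ⟩
    2                           ∎)

codeword-in-nbhd-unique : ∀ {n} c (x u v : GridV n) → IsCodeword c (coords u) → IsCodeword c (coords v) →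
                          T (inClosedNbhd x u) → T (inClosedNbhd x v) → u ≡ v
codeword-in-nbhd-unique c (i , j) (i' , j') (i'' , j'') u-code v-code x~u x~v
  with inClosedNbhd⇒Step i j i' j' x~u | inClosedNbhd⇒Step i j i'' j'' x~v
... | d , x→u | e , x→v with offset-injective d e (%-cancelˡ-+ (value c (toℕ i , toℕ j))
                               (trans (to (codeword⇔ c d x→u) u-code) (sym (to (codeword⇔ c e x→v) v-code))))
... | refl = coords-injective (step-functional d x→u x→v)

codeSet-unique : ∀ n c → Unique (codeSet n c)
codeSet-unique n c = Unique.filter⁺ _ (gridVertices-unique n)

codeSet-is2Packing : ∀ n c → Is2Packing (codeSet n c)
codeSet-is2Packing n c = codeSet-unique n c , λ x →
  length-filter≤1 (T? ∘ inClosedNbhd x) (codeSet-unique n c) λ u∈ v∈ →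
    codeword-in-nbhd-unique c x _ _ (proj₂ (∈-filter⁻ (isCodeword? c) {xs = gridVertices n} u∈))
                                    (proj₂ (∈-filter⁻ (isCodeword? c) {xs = gridVertices n} v∈))

-- In the infinite grid, a point of residue s is dominated by its neighbour in direction
-- dominator s (by dominator-offset and codeword⇔); residues s ≥ 5 do not occur.
dominator : ℕ → Dir
dominator 0 = centre
dominator 1 = west
dominator 2 = south
dominator 3 = north
dominator 4 = east
dominator _ = centre

dominator-offset : ∀ s → s < 5 → (s + offset (dominator s)) % 5 ≡ 2
dominator-offset 0 _ = refl
dominator-offset 1 _ = refl
dominator-offset 2 _ = refl
dominator-offset 3 _ = refl
dominator-offset 4 _ = refl
dominator-offset (suc (suc (suc (suc (suc _))))) (s≤s (s≤s (s≤s (s≤s (s≤s ())))))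

defect : ℕ → ℕ → ℕ × ℕ → ℕ
defect n c p = 𝟙 (exits n (dominator (value c p % 5)) p)

defects : ℕ → ℕ → ℕ
defects n c = ∑[ x ∈ gridVertices n ] defect n c (coords x)

dominated-or-defect : ∀ {n} c (x : GridV n) → 1 ≤ closedNbhdCount x (codeSet n c) + defect n c (coords x)
dominated-or-defect {n} c x@(i , j) with step-or-exits (dominator (value c (coords x) % 5)) x
... | inj₁ out = ≤-trans (T⇒1≤𝟙 out) (m≤n+m _ _)
... | inj₂ (u@(i' , j') , x→u) = ≤-trans (1≤length x~u∈S) (m≤m+n _ _)
  where
  s : ℕ
  s = value c (coords x) % 5
  u-code : IsCodeword c (coords u)
  u-code = from (codeword⇔ c (dominator s) x→u)
                (trans ([m+k]%n≡[m%n+k]%n (value c (coords x)) _ 5) (dominator-offset s (m%n<n (value c (coords x)) 5)))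
  u∈S : u ∈ codeSet n c
  u∈S = ∈-filter⁺ (isCodeword? c) (∈-gridVertices u) u-code
  x~u∈S : u ∈ filter (T? ∘ inClosedNbhd x) (codeSet n c)
  x~u∈S = ∈-filter⁺ (T? ∘ inClosedNbhd x) u∈S (Step⇒inClosedNbhd i j i' j' (dominator s) x→u)

∑-inClosedNbhd≤ : ∀ {n} (u : GridV n) → ∑[ x ∈ gridVertices n ] 𝟙 (inClosedNbhd x u) ≤ suc (gridDeg u)
∑-inClosedNbhd≤ {n} u = begin
  ∑[ x ∈ V ] 𝟙 (inClosedNbhd x u)                      ≤⟨ ∑-mono-≤ V (λ x → 𝟙-∨ (u ≟V x) (gridAdj x u)) ⟩
  ∑[ x ∈ V ] (𝟙 (u ≟V x) + 𝟙 (gridAdj x u))           ≡⟨ ∑-distrib-+ (𝟙 ∘ (u ≟V_)) (λ x → 𝟙 (gridAdj x u)) V ⟩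
  ∑[ x ∈ V ] 𝟙 (u ≟V x) + ∑[ x ∈ V ] 𝟙 (gridAdj x u)   ≡⟨ cong₂ _+_ (sym (length-filter≡∑𝟙 (u ≟V_) V)) adj-count ⟩
  length (filter (T? ∘ (u ≟V_)) V) + gridDeg u        ≤⟨ +-monoˡ-≤ (gridDeg u) self-count ⟩
  suc (gridDeg u)                                     ∎
  where
  open ≤-Reasoning
  V : List (GridV n)
  V = gridVertices n
  adj-count : ∑[ x ∈ V ] 𝟙 (gridAdj x u) ≡ gridDeg u
  adj-count = trans (∑-cong V (λ x → cong 𝟙 (gridAdj-sym x u))) (sym (length-filter≡∑𝟙 (gridAdj u) V))
  self-count : length (filter (T? ∘ (u ≟V_)) V) ≤ 1
  self-count = length-filter≤1 (T? ∘ (u ≟V_)) (gridVertices-unique n) (λ {x} {y} _ _ t t' → trans (sym (≟V⇒≡ u x t)) (≟V⇒≡ u y t'))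

∑-closedNbhdCount≤weight : ∀ {n} (S : List (GridV n)) → ∑[ x ∈ gridVertices n ] closedNbhdCount x S ≤ weight S
∑-closedNbhdCount≤weight {n} S = begin
  ∑[ x ∈ V ] closedNbhdCount x S              ≡⟨ ∑-cong V (λ x → length-filter≡∑𝟙 (inClosedNbhd x) S) ⟩
  ∑[ x ∈ V ] ∑[ u ∈ S ] 𝟙 (inClosedNbhd x u)  ≡⟨ ∑-comm (λ x u → 𝟙 (inClosedNbhd x u)) V S ⟩
  ∑[ u ∈ S ] ∑[ x ∈ V ] 𝟙 (inClosedNbhd x u)  ≤⟨ ∑-mono-≤ S ∑-inClosedNbhd≤ ⟩
  weight S                                    ∎
  where
  open ≤-Reasoning
  V : List (GridV n)
  V = gridVertices n

n*n≤weight+defects : ∀ n c → n * n ≤ weight (codeSet n c) + defects n c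
n*n≤weight+defects n c = begin
  n * n                                                      ≡⟨ ∑-gridVertices-1 n ⟨
  ∑[ x ∈ V ] 1                                               ≤⟨ ∑-mono-≤ V (dominated-or-defect c) ⟩
  ∑[ x ∈ V ] (closedNbhdCount x S + defect n c (coords x))  ≡⟨ ∑-distrib-+ (λ x → closedNbhdCount x S) (defect n c ∘ coords) V ⟩
  ∑[ x ∈ V ] closedNbhdCount x S + defects n c              ≤⟨ +-monoˡ-≤ (defects n c) (∑-closedNbhdCount≤weight S) ⟩
  weight S + defects n c                                     ∎
  where
  open ≤-Reasoning
  V : List (GridV n)
  V = gridVertices n
  S : List (GridV n)
  S = codeSet n c

F-grid≥-codeSet : ∀ {n m} c → defects n c ≤ m → F-grid≥ n (n * n ∸ m)
F-grid≥-codeSet {n} {m} c defects≤m = codeSet n c , codeSet-is2Packing n c , (begin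
  n * n ∸ m                  ≤⟨ ∸-monoʳ-≤ (n * n) defects≤m ⟩
  n * n ∸ defects n c        ≤⟨ m≤n+o⇒m∸n≤o (n * n) (defects n c) (≤-trans (n*n≤weight+defects n c) (≤-reflexive (+-comm (weight (codeSet n c)) (defects n c)))) ⟩
  weight (codeSet n c)       ∎)
  where open ≤-Reasoning

residueCount : ℕ → ℕ → ℕ → ℕ → ℕ
residueCount A B t n = ∑[ b < n ] 𝟙 ((A + B * b) % 5 ≡ᵇ t)

residueCount-line : ∀ {f : ℕ → ℕ} A B t n → (∀ b → f b ≡ A + B * b) →
                    ∑[ b < n ] 𝟙 (f b % 5 ≡ᵇ t) ≡ residueCount A B t n
residueCount-line A B t n f≡ = ∑<-cong n (λ b → cong (λ r → 𝟙 (r % 5 ≡ᵇ t)) (f≡ b))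

residueCount-cong : ∀ A A' B t n → A % 5 ≡ A' % 5 → residueCount A B t n ≡ residueCount A' B t n
residueCount-cong A A' B t n A≡A' = ∑<-cong n (λ b → cong (λ r → 𝟙 (r ≡ᵇ t)) (begin
  (A + B * b) % 5        ≡⟨ [m+k]%n≡[m%n+k]%n A (B * b) 5 ⟩
  (A % 5 + B * b) % 5    ≡⟨ cong (λ r → (r + B * b) % 5) A≡A' ⟩
  (A' % 5 + B * b) % 5   ≡⟨ [m+k]%n≡[m%n+k]%n A' (B * b) 5 ⟨
  (A' + B * b) % 5       ∎))
  where open ≡-Reasoning

residueCount-+ : ∀ A B t R K →
                 residueCount A B t (R + K * 5) ≡ residueCount A B t R + K * residueCount (A + B * R) B t 5
residueCount-+ A B t R K = begin
  residueCount A B t (R + K * 5)                                        ≡⟨ ∑<-+ R (K * 5) _ ⟩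
  residueCount A B t R + ∑[ b < K * 5 ] 𝟙 ((A + B * (R + b)) % 5 ≡ᵇ t)  ≡⟨ cong (residueCount A B t R +_) (residueCount-line (A + B * R) B t (K * 5) (shift A B R)) ⟩
  residueCount A B t R + residueCount (A + B * R) B t (K * 5)           ≡⟨ cong (residueCount A B t R +_) (∑<-periodic K 5 _ periodic) ⟩
  residueCount A B t R + K * residueCount (A + B * R) B t 5             ∎
  where
  open ≡-Reasoning
  shift : ∀ A B R b → A + B * (R + b) ≡ A + B * R + B * b
  shift = solve-∀
  wrap : ∀ A B b → A + B * (5 + b) ≡ A + B * b + B * 5
  wrap = solve-∀
  periodic : ∀ b → 𝟙 ((A + B * R + B * (5 + b)) % 5 ≡ᵇ t) ≡ 𝟙 ((A + B * R + B * b) % 5 ≡ᵇ t)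
  periodic b = cong (λ r → 𝟙 (r ≡ᵇ t)) (trans (cong (_% 5) (wrap (A + B * R) B b)) ([m+kn]%n≡m%n (A + B * R + B * b) B 5))

module _ (m c : ℕ) where
  private
    n : ℕ
    n = suc m
    s : ℕ → ℕ → ℕ
    s a b = value c (a , b) % 5
    -- A vertex of residue 1, 4, 2 or 3 can only be undominated on the west, east, south
    -- or north side respectively.
    border : ℕ → ℕ → ℕ → ℕ
    border r a b = 𝟙 (r ≡ᵇ 1) * 𝟙 (a ≡ᵇ 0) + (𝟙 (r ≡ᵇ 4) * 𝟙 (a ≡ᵇ m)
                 + (𝟙 (r ≡ᵇ 2) * 𝟙 (b ≡ᵇ 0) + 𝟙 (r ≡ᵇ 3) * 𝟙 (b ≡ᵇ m)))
    westTerm eastTerm southTerm northTerm : ℕ → ℕ → ℕ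
    westTerm  a b = 𝟙 (s a b ≡ᵇ 1) * 𝟙 (a ≡ᵇ 0)
    eastTerm  a b = 𝟙 (s a b ≡ᵇ 4) * 𝟙 (a ≡ᵇ m)
    southTerm a b = 𝟙 (s a b ≡ᵇ 2) * 𝟙 (b ≡ᵇ 0)
    northTerm a b = 𝟙 (s a b ≡ᵇ 3) * 𝟙 (b ≡ᵇ m)

    exits≤border : ∀ r a b → 𝟙 (exits n (dominator r) (a , b)) ≤ border r a b
    exits≤border 0 a b = z≤n
    exits≤border 1 a b = ≤-trans (m≤m+n _ 0) (m≤m+n _ 0)
    exits≤border 2 a b = ≤-trans (m≤m+n _ 0) (m≤m+n _ 0)
    exits≤border 3 a b = m≤m+n _ 0
    exits≤border 4 a b = ≤-trans (m≤m+n _ 0) (m≤m+n _ 0)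
    exits≤border (suc (suc (suc (suc (suc _))))) a b = z≤n

    collapse-row : ∀ k (f : ℕ → ℕ → ℕ) → k < n → ∑[ a < n ] ∑[ b < n ] (f a b * 𝟙 (a ≡ᵇ k)) ≡ ∑[ b < n ] f k b
    collapse-row k f k<n = trans (∑<-cong n (λ a → ∑<-*ʳ n (𝟙 (a ≡ᵇ k)) (f a))) (∑<-select (λ a → ∑< n (f a)) k<n)

    collapse-col : ∀ k (f : ℕ → ℕ → ℕ) → k < n → ∑[ a < n ] ∑[ b < n ] (f a b * 𝟙 (b ≡ᵇ k)) ≡ ∑[ a < n ] f a k
    collapse-col k f k<n = ∑<-cong n (λ a → ∑<-select (f a) k<n)

    east-value : ∀ m b c → m + 2 * b + c ≡ m + c + 2 * b
    east-value = solve-∀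
    south-value : ∀ a c → a + 2 * 0 + c ≡ c + 1 * a
    south-value = solve-∀
    north-value : ∀ a m c → a + 2 * m + c ≡ 2 * m + c + 1 * a
    north-value = solve-∀

    west-line : ∑[ a < n ] ∑< n (westTerm a) ≡ residueCount c 2 1 n
    west-line = trans (collapse-row 0 (λ a b → 𝟙 (s a b ≡ᵇ 1)) (s≤s z≤n)) (residueCount-line c 2 1 n (λ b → +-comm (2 * b) c))
    east-line : ∑[ a < n ] ∑< n (eastTerm a) ≡ residueCount (m + c) 2 4 n
    east-line = trans (collapse-row m (λ a b → 𝟙 (s a b ≡ᵇ 4)) ≤-refl) (residueCount-line (m + c) 2 4 n (λ b → east-value m b c))
    south-line : ∑[ a < n ] ∑< n (southTerm a) ≡ residueCount c 1 2 n
    south-line = trans (collapse-col 0 (λ a b → 𝟙 (s a b ≡ᵇ 2)) (s≤s z≤n)) (residueCount-line c 1 2 n (λ a → south-value a c))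
    north-line : ∑[ a < n ] ∑< n (northTerm a) ≡ residueCount (2 * m + c) 1 3 n
    north-line = trans (collapse-col m (λ a b → 𝟙 (s a b ≡ᵇ 3)) ≤-refl) (residueCount-line (2 * m + c) 1 3 n (λ a → north-value a m c))

  defects-≤-borders : defects n c ≤ residueCount c 2 1 n + (residueCount (m + c) 2 4 n
                                   + (residueCount c 1 2 n + residueCount (2 * m + c) 1 3 n))
  defects-≤-borders = begin
    defects n c                                        ≡⟨ ∑-gridVertices n (defect n c) ⟩
    ∑[ a < n ] ∑[ b < n ] defect n c (a , b)           ≤⟨ ∑<-mono-≤ n (λ a → ∑<-mono-≤ n (λ b → exits≤border (s a b) a b)) ⟩
    ∑[ a < n ] ∑[ b < n ] border (s a b) a b           ≡⟨ ∑<-cong n (λ a → ∑<-distrib-+₄ n (westTerm a) (eastTerm a) (southTerm a) (northTerm a)) ⟩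
    ∑[ a < n ] (∑< n (westTerm a) + (∑< n (eastTerm a) + (∑< n (southTerm a) + ∑< n (northTerm a))))
                                                       ≡⟨ ∑<-distrib-+₄ n (∑< n ∘ westTerm) (∑< n ∘ eastTerm) (∑< n ∘ southTerm) (∑< n ∘ northTerm) ⟩
    _                                                  ≡⟨ cong₂ _+_ west-line (cong₂ _+_ east-line (cong₂ _+_ south-line north-line)) ⟩
    _                                                  ∎
    where open ≤-Reasoning

-- For concrete R and c every count below is a numeral; each window of five consecutive
-- vertices of a side contains exactly one vertex of that side's residue.
defects-periodic : ∀ R c K → defects (suc R + K * 5) c ≤
    residueCount c 2 1 (suc R) + K * residueCount (c + 2 * suc R) 2 1 5
  + (residueCount (R + c) 2 4 (suc R) + K * residueCount (R + c + 2 * suc R) 2 4 5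
  + (residueCount c 1 2 (suc R) + K * residueCount (c + 1 * suc R) 1 2 5
  + (residueCount (2 * R + c) 1 3 (suc R) + K * residueCount (2 * R + c + 1 * suc R) 1 3 5)))
defects-periodic R c K = ≤-trans (defects-≤-borders (R + K * 5) c) (≤-reflexive
  (cong₂ _+_ (residueCount-+ c 2 1 (suc R) K)
  (cong₂ _+_ (trans (residueCount-cong (R + K * 5 + c) (R + c) 2 4 n (%5-reduce (R + c) K (east-offset R K c))) (residueCount-+ (R + c) 2 4 (suc R) K))
  (cong₂ _+_ (residueCount-+ c 1 2 (suc R) K)
             (trans (residueCount-cong (2 * (R + K * 5) + c) (2 * R + c) 1 3 n (%5-reduce (2 * R + c) (2 * K) (north-offset R K c))) (residueCount-+ (2 * R + c) 1 3 (suc R) K))))))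
  where
  n : ℕ
  n = suc R + K * 5
  %5-reduce : ∀ {x} y k → x ≡ y + k * 5 → x % 5 ≡ y % 5
  %5-reduce y k x≡ = trans (cong (_% 5) x≡) ([m+kn]%n≡m%n y k 5)
  east-offset : ∀ R K c → R + K * 5 + c ≡ R + c + K * 5
  east-offset = solve-∀
  north-offset : ∀ R K c → 2 * (R + K * 5) + c ≡ 2 * R + c + (2 * K) * 5
  north-offset = solve-∀

defects-5K : ∀ K → defects (0 + K * 5) 0 ≤ 4 * K
defects-5K zero = z≤n
defects-5K (suc K) = ≤-trans (defects-periodic 4 0 K) (≤-reflexive (count K))
  where count : ∀ K → 1 + K * 1 + (1 + K * 1 + (1 + K * 1 + (1 + K * 1))) ≡ 4 * suc K
        count = solve-∀

defects-5K+1 : ∀ K → defects (1 + K * 5) 0 ≤ 4 * K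
defects-5K+1 K = ≤-trans (defects-periodic 0 0 K) (≤-reflexive (count K))
  where count : ∀ K → K * 1 + (K * 1 + (K * 1 + K * 1)) ≡ 4 * K
        count = solve-∀

defects-5K+2 : ∀ K → defects (2 + K * 5) 0 ≤ 4 * K + 1
defects-5K+2 K = ≤-trans (defects-periodic 1 0 K) (≤-reflexive (count K))
  where count : ∀ K → K * 1 + (K * 1 + (K * 1 + (1 + K * 1))) ≡ 4 * K + 1
        count = solve-∀

defects-5K+3 : ∀ K → defects (3 + K * 5) 0 ≤ 4 * K + 2
defects-5K+3 K = ≤-trans (defects-periodic 2 0 K) (≤-reflexive (count K))
  where count : ∀ K → K * 1 + (1 + K * 1 + (1 + K * 1 + K * 1)) ≡ 4 * K + 2
        count = solve-∀

defects-5K+4 : ∀ K → defects (4 + K * 5) 3 ≤ 4 * K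
defects-5K+4 K = ≤-trans (defects-periodic 3 3 K) (≤-reflexive (count K))
  where count : ∀ K → K * 1 + (K * 1 + (K * 1 + K * 1)) ≡ 4 * K
        count = solve-∀

n*n∸n+K+1≡n*n∸[4K+r] : ∀ r K → let n = suc r + K * 5 in n * n ∸ n + K + 1 ≡ n * n ∸ (4 * K + r)
n*n∸n+K+1≡n*n∸[4K+r] r K = begin
  n * n ∸ n + K + 1                                   ≡⟨ m+n∸n≡m (n * n ∸ n + K + 1) (4 * K + r) ⟨
  n * n ∸ n + K + 1 + (4 * K + r) ∸ (4 * K + r)       ≡⟨ cong (_∸ (4 * K + r)) (regroup (n * n ∸ n) K r) ⟩
  n * n ∸ n + n ∸ (4 * K + r)                         ≡⟨ cong (_∸ (4 * K + r)) (m∸n+n≡m (m≤m*n n n)) ⟩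
  n * n ∸ (4 * K + r)                                 ∎
  where
  open ≡-Reasoning
  n : ℕ
  n = suc r + K * 5
  regroup : ∀ Z K r → Z + K + 1 + (4 * K + r) ≡ Z + (suc r + K * 5)
  regroup = solve-∀

-- The construction works for every n.
mainTheorem7 : (n : ℕ) → 7 ≤ n →
    ((n % 5 ≡ 0 ⊎ n % 5 ≡ 1 ⊎ n % 5 ≡ 4) → F-grid≥ n (n * n ∸ 4 * (n / 5)))
    × ((n % 5 ≡ 2 ⊎ n % 5 ≡ 3) → F-grid≥ n (n * n ∸ n + n / 5 + 1))
mainTheorem7 n _ = residue-0-1-4 , residue-2-3
  where
  K : ℕ
  K = n / 5
  byResidue : ∀ {r} (P : ℕ → Set) → n % 5 ≡ r → P (r + K * 5) → P n
  byResidue P n%5≡r = subst P (sym (trans (m≡m%n+[m/n]*n n 5) (cong (_+ K * 5) n%5≡r)))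
  BoundA BoundB : ℕ → Set
  BoundA N = F-grid≥ N (N * N ∸ 4 * K)
  BoundB N = F-grid≥ N (N * N ∸ N + K + 1)
  residue-0-1-4 : (n % 5 ≡ 0 ⊎ n % 5 ≡ 1 ⊎ n % 5 ≡ 4) → BoundA n
  residue-0-1-4 (inj₁ r0)        = byResidue BoundA r0 (F-grid≥-codeSet 0 (defects-5K K))
  residue-0-1-4 (inj₂ (inj₁ r1)) = byResidue BoundA r1 (F-grid≥-codeSet 0 (defects-5K+1 K))
  residue-0-1-4 (inj₂ (inj₂ r4)) = byResidue BoundA r4 (F-grid≥-codeSet 3 (defects-5K+4 K))
  residue-2-3 : (n % 5 ≡ 2 ⊎ n % 5 ≡ 3) → BoundB n
  residue-2-3 (inj₁ r2) = byResidue BoundB r2 (subst (F-grid≥ _) (sym (n*n∸n+K+1≡n*n∸[4K+r] 1 K)) (F-grid≥-codeSet 0 (defects-5K+2 K)))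
  residue-2-3 (inj₂ r3) = byResidue BoundB r3 (subst (F-grid≥ _) (sym (n*n∸n+K+1≡n*n∸[4K+r] 2 K)) (F-grid≥-codeSet 0 (defects-5K+3 K)))
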